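{- Let $T\in[0\mathinner{.\,.}\sigma)^n$, with $\sigma\ge3$, be a nonempty string and let $k=\lceil\log\sigma\rceil$. For every $a\in[0\mathinner{.\,.}\sigma)$ let $C(a)=1^{k+1}\cdot0\cdot\mathrm{bin}_k(a)\cdot0$. Let $S=C(T[1])C(T[2])\cdots C(T[n])$, $\Delta=|S|-|T|$, and $\delta=2k+3$. Then for every $j\in[1\mathinner{.\,.}n]$, $\mathrm{ISA}_T[j]=\mathrm{ISA}_S[(j-1)\delta+1]-\Delta$.
   Context: For $x\in[0\mathinner{.\,.}2^k)$, $\mathrm{bin}_k(x)\in\{0,1\}^k$ is the binary representation of $x$ with leading zeros. For a string $X$ of length $N$, $\mathrm{SA}_X$ lists the starting positions of the suffixes $X[i\mathinner{.\,.}N]$ in lexicographic order (a proper prefix is smaller), and $\mathrm{ISA}_X$ is its inverse permutation ($\mathrm{ISA}_X[j]$ is the rank of $X[j\mathinner{.\,.}N]$). -}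

module Defs where

open import Data.Bool using (Bool; true; false; _∧_; _∨_)
open import Data.Nat using (ℕ; zero; suc; _+_; _*_; _∸_; _/_; _%_; _<ᵇ_; _≡ᵇ_)
open import Data.List using (List; []; _∷_; _++_; [_]; length; drop; filterᵇ; upTo; replicate; concatMap)

lexLt : List ℕ → List ℕ → Bool
lexLt []       []       = false
lexLt []       (_ ∷ _)  = true
lexLt (_ ∷ _)  []       = false
lexLt (x ∷ xs) (y ∷ ys) = (x <ᵇ y) ∨ ((x ≡ᵇ y) ∧ lexLt xs ys)

suffix : List ℕ → ℕ → List ℕ
suffix X j = drop (j ∸ 1) X

-- ISA_X[j] (1-indexed position, 1-indexed rank): the rank of X[j..N] among
-- all suffixes X[i..N], i ∈ [1..N], in lexicographic order
-- = 1 + number of suffixes strictly smaller than X[j..N].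
ISA : List ℕ → ℕ → ℕ
ISA X j = suc (length (filterᵇ (λ i → lexLt (suffix X (suc i)) (suffix X j)) (upTo (length X))))

bin : ℕ → ℕ → List ℕ
bin zero    x = []
bin (suc k) x = bin k (x / 2) ++ [ x % 2 ]

C : ℕ → ℕ → List ℕ
C k a = replicate (suc k) 1 ++ (0 ∷ bin k a ++ [ 0 ])

encode : ℕ → List ℕ → List ℕ
encode k T = concatMap (C k) T

{-# OPTIONS --safe #-}

-- Since σ ≤ 2^k, bin_k is order-preserving on the alphabet, and all codes have
-- the same length δ = 2k+3; so comparing encodings of two strings amounts to comparing the
-- strings. A suffix of S starting strictly inside a code is a bit string with a 0 among its
-- first k+1 symbols, hence lies below every suffix starting at a code boundary (these begin
-- with 1^{k+1}). The suffix at (j-1)δ+1 is a boundary suffix, so its rank in S is the rank of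
-- T[j..n] in T plus the number n(δ-1) = Δ of interior suffixes.
module Submission where

open import Defs
open import Data.Bool using (Bool; true; false; _∧_; _∨_; if_then_else_)
open import Data.Nat using (ℕ; zero; suc; _+_; _*_; _∸_; _^_; _≤_; _<_; z≤n; s≤s; _<ᵇ_; _≡ᵇ_; ⌊_/2⌋; ⌈_/2⌉; _/_; _%_)
open import Data.Nat.Properties
open import Data.Nat.DivMod using (m≡m%n+[m/n]*n; m%n<n; m<n*o⇒m/o<n)
open import Data.Nat.Induction using (<-wellFounded)
open import Data.Nat.Logarithm using (⌈log₂_⌉)
open import Data.Nat.Logarithm.Core using (⌈log2⌉)
open import Data.Nat.Tactic.RingSolver using (solve; solve-∀)
import Data.List as List
open import Data.List using (List; []; _∷_; _++_; [_]; length; drop; filterᵇ; applyUpTo; replicate)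
open import Data.List.Properties using (++-assoc; length-++; length-replicate; drop-[]; ∷-injectiveʳ)
open import Data.List.Relation.Unary.All using (All; []; _∷_)
import Data.List.Relation.Unary.All as All
open import Data.List.Relation.Unary.All.Properties using (++⁺; drop⁺; replicate⁺)
open import Data.Product using (∃₂; _,_)
open import Function using (_∘_)
open import Induction.WellFounded using (Acc; acc)
open import Relation.Binary using (tri<; tri≈; tri>)
open import Relation.Binary.PropositionalEquality using (_≡_; refl; sym; trans; cong; cong₂; subst; module ≡-Reasoning)

lexStep : ℕ → ℕ → Bool → Bool
lexStep x y b = (x <ᵇ y) ∨ ((x ≡ᵇ y) ∧ b)

lexStep-< : ∀ {x y} b → x < y → lexStep x y b ≡ true
lexStep-< {zero}  {suc y} b _         = refl
lexStep-< {suc x} {suc y} b (s≤s x<y) = lexStep-< b x<y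

lexStep-> : ∀ {x y} b → y < x → lexStep x y b ≡ false
lexStep-> {suc x} {zero}  b _         = refl
lexStep-> {suc x} {suc y} b (s≤s y<x) = lexStep-> b y<x

lexStep-≡ : ∀ x b → lexStep x x b ≡ b
lexStep-≡ zero    b = refl
lexStep-≡ (suc x) b = lexStep-≡ x b

lexStep-+ : ∀ n x y b → lexStep (n + x) (n + y) b ≡ lexStep x y b
lexStep-+ zero    x y b = refl
lexStep-+ (suc n) x y b = lexStep-+ n x y b

a<b⇒r+a*m<s+b*m : ∀ {m a b} r s → r < m → a < b → r + a * m < s + b * m
a<b⇒r+a*m<s+b*m {m} {a} {b} r s r<m a<b = begin-strict
  r + a * m  <⟨ +-monoˡ-< (a * m) r<m ⟩
  suc a * m  ≤⟨ *-monoˡ-≤ m a<b ⟩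
  b * m      ≤⟨ m≤n+m (b * m) s ⟩
  s + b * m  ∎
  where open ≤-Reasoning

lexStep-digits : ∀ {m} a b {r s} z → r < m → s < m →
                 lexStep a b (lexStep r s z) ≡ lexStep (r + a * m) (s + b * m) z
lexStep-digits {m} a b {r} {s} z r<m s<m with <-cmp a b
... | tri< a<b _ _ = trans (lexStep-< _ a<b) (sym (lexStep-< z (a<b⇒r+a*m<s+b*m r s r<m a<b)))
... | tri> _ _ b<a = trans (lexStep-> _ b<a) (sym (lexStep-> z (a<b⇒r+a*m<s+b*m s r s<m b<a)))
... | tri≈ _ refl _ = begin
  lexStep a a (lexStep r s z)          ≡⟨ lexStep-≡ a _ ⟩
  lexStep r s z                        ≡⟨ lexStep-+ (a * m) r s z ⟨
  lexStep (a * m + r) (a * m + s) z    ≡⟨ cong₂ (λ x y → lexStep x y z) (+-comm (a * m) r) (+-comm (a * m) s) ⟩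
  lexStep (r + a * m) (s + a * m) z    ∎
  where open ≡-Reasoning

lexLt-++-cancelˡ : ∀ P xs ys → lexLt (P ++ xs) (P ++ ys) ≡ lexLt xs ys
lexLt-++-cancelˡ []      xs ys = refl
lexLt-++-cancelˡ (p ∷ P) xs ys = trans (lexStep-≡ p _) (lexLt-++-cancelˡ P xs ys)

bin-length : ∀ k u → length (bin k u) ≡ k
bin-length zero    u = refl
bin-length (suc k) u = trans (length-++ (bin k (u / 2))) (trans (cong (_+ 1) (bin-length k (u / 2))) (+-comm k 1))

bin-bits : ∀ k u → All (_≤ 1) (bin k u)
bin-bits zero    u = []
bin-bits (suc k) u = ++⁺ (bin-bits k (u / 2)) (≤-pred (m%n<n u 2) ∷ [])

bin-lexLt : ∀ k {u v} X Y → u < 2 ^ k → v < 2 ^ k →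
            lexLt (bin k u ++ X) (bin k v ++ Y) ≡ lexStep u v (lexLt X Y)
bin-lexLt zero    X Y (s≤s z≤n) (s≤s z≤n) = refl
bin-lexLt (suc k) {u} {v} X Y u<2^k+1 v<2^k+1 = begin
  lexLt ((bin k (u / 2) ++ [ u % 2 ]) ++ X) ((bin k (v / 2) ++ [ v % 2 ]) ++ Y)
    ≡⟨ cong₂ lexLt (++-assoc (bin k (u / 2)) _ X) (++-assoc (bin k (v / 2)) _ Y) ⟩
  lexLt (bin k (u / 2) ++ u % 2 ∷ X) (bin k (v / 2) ++ v % 2 ∷ Y)
    ≡⟨ bin-lexLt k _ _ (half-< u<2^k+1) (half-< v<2^k+1) ⟩
  lexStep (u / 2) (v / 2) (lexStep (u % 2) (v % 2) (lexLt X Y))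
    ≡⟨ lexStep-digits (u / 2) (v / 2) _ (m%n<n u 2) (m%n<n v 2) ⟩
  lexStep (u % 2 + u / 2 * 2) (v % 2 + v / 2 * 2) (lexLt X Y)
    ≡⟨ cong₂ (λ x y → lexStep x y (lexLt X Y)) (m≡m%n+[m/n]*n u 2) (m≡m%n+[m/n]*n v 2) ⟨
  lexStep u v (lexLt X Y) ∎
  where
  open ≡-Reasoning
  half-< : ∀ {w} → w < 2 ^ suc k → w / 2 < 2 ^ k
  half-< {w} w< = m<n*o⇒m/o<n (subst (w <_) (*-comm 2 (2 ^ k)) w<)

C-++ : ∀ k u X → C k u ++ X ≡ replicate (suc k) 1 ++ 0 ∷ bin k u ++ 0 ∷ X
C-++ k u X = begin
  (replicate (suc k) 1 ++ 0 ∷ bin k u ++ [ 0 ]) ++ X ≡⟨ ++-assoc (replicate (suc k) 1) _ X ⟩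
  replicate (suc k) 1 ++ 0 ∷ (bin k u ++ [ 0 ]) ++ X ≡⟨ cong (λ Z → replicate (suc k) 1 ++ 0 ∷ Z) (++-assoc (bin k u) _ X) ⟩
  replicate (suc k) 1 ++ 0 ∷ bin k u ++ 0 ∷ X       ∎
  where open ≡-Reasoning

C-lexLt : ∀ k {u v} X Y → u < 2 ^ k → v < 2 ^ k →
          lexLt (C k u ++ X) (C k v ++ Y) ≡ lexStep u v (lexLt X Y)
C-lexLt k {u} {v} X Y u<2^k v<2^k = begin
  lexLt (C k u ++ X) (C k v ++ Y)
    ≡⟨ cong₂ lexLt (C-++ k u X) (C-++ k v Y) ⟩
  lexLt (replicate (suc k) 1 ++ 0 ∷ bin k u ++ 0 ∷ X) (replicate (suc k) 1 ++ 0 ∷ bin k v ++ 0 ∷ Y)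
    ≡⟨ lexLt-++-cancelˡ (replicate (suc k) 1) _ _ ⟩
  lexLt (bin k u ++ 0 ∷ X) (bin k v ++ 0 ∷ Y)
    ≡⟨ bin-lexLt k _ _ u<2^k v<2^k ⟩
  lexStep u v (lexLt X Y) ∎
  where open ≡-Reasoning

encode-lexLt : ∀ k U V → All (_< 2 ^ k) U → All (_< 2 ^ k) V →
               lexLt (encode k U) (encode k V) ≡ lexLt U V
encode-lexLt k []      []      _          _          = refl
encode-lexLt k []      (v ∷ V) _          _          = refl
encode-lexLt k (u ∷ U) []      _          _          = refl
encode-lexLt k (u ∷ U) (v ∷ V) (u< ∷ U<) (v< ∷ V<) =
  trans (C-lexLt k _ _ u< v<) (cong (lexStep u v) (encode-lexLt k U V U< V<))

C-length : ∀ k u → length (C k u) ≡ 2 * k + 3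
C-length k u = begin
  length (replicate (suc k) 1 ++ 0 ∷ bin k u ++ [ 0 ])
    ≡⟨ length-++ (replicate (suc k) 1) ⟩
  length (replicate (suc k) 1) + suc (length (bin k u ++ [ 0 ]))
    ≡⟨ cong₂ (λ a b → a + suc b) (length-replicate (suc k)) (length-++ (bin k u)) ⟩
  suc k + suc (length (bin k u) + 1)
    ≡⟨ cong (λ b → suc k + suc (b + 1)) (bin-length k u) ⟩
  suc k + suc (k + 1)
    ≡⟨ solve (k List.∷ List.[]) ⟩
  2 * k + 3 ∎
  where open ≡-Reasoning

encode-length : ∀ k T → length (encode k T) ≡ length T * (2 * k + 3)
encode-length k []      = refl
encode-length k (u ∷ T) = trans (length-++ (C k u)) (cong₂ _+_ (C-length k u) (encode-length k T))

drop-++-length : ∀ {A : Set} (xs ys : List A) n → drop (length xs + n) (xs ++ ys) ≡ drop n ys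
drop-++-length []       ys n = refl
drop-++-length (x ∷ xs) ys n = drop-++-length xs ys n

drop-encode : ∀ k q T → drop (q * (2 * k + 3)) (encode k T) ≡ encode k (drop q T)
drop-encode k zero    T       = refl
drop-encode k (suc q) []      = drop-[] (suc q * (2 * k + 3))
drop-encode k (suc q) (u ∷ T) = begin
  drop ((2 * k + 3) + q * (2 * k + 3)) (C k u ++ encode k T)
    ≡⟨ cong (λ n → drop (n + q * (2 * k + 3)) (C k u ++ encode k T)) (C-length k u) ⟨
  drop (length (C k u) + q * (2 * k + 3)) (C k u ++ encode k T)
    ≡⟨ drop-++-length (C k u) (encode k T) (q * (2 * k + 3)) ⟩
  drop (q * (2 * k + 3)) (encode k T)
    ≡⟨ drop-encode k q T ⟩
  encode k (drop q T) ∎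
  where open ≡-Reasoning

suffix-encode : ∀ k q T → suffix (encode k T) (q * (2 * k + 3) + 1) ≡ encode k (drop q T)
suffix-encode k q T =
  trans (cong (λ m → drop m (encode k T)) (m+n∸n≡m (q * (2 * k + 3)) 1)) (drop-encode k q T)

lexLt-bits-ones : ∀ {k} B R Q → All (_≤ 1) B → length B ≤ k →
                  lexLt (B ++ 0 ∷ R) (replicate (suc k) 1 ++ Q) ≡ true
lexLt-bits-ones []      R Q _                  _         = refl
lexLt-bits-ones (b ∷ B) R Q (z≤n ∷ _)          _         = refl
lexLt-bits-ones (b ∷ B) R Q (s≤s z≤n ∷ B-bits) (s≤s |B|≤k) = lexLt-bits-ones B R Q B-bits |B|≤k

countSuffixesBelow : List ℕ → List ℕ → ℕ
countSuffixesBelow []           Y = 0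
countSuffixesBelow X@(_ ∷ X′) Y = (if lexLt X Y then 1 else 0) + countSuffixesBelow X′ Y

length-filter-drop : ∀ X Y (f : ℕ → ℕ) (p : ℕ → Bool) → (∀ i → p (f i) ≡ lexLt (drop i X) Y) →
                     length (filterᵇ p (applyUpTo f (length X))) ≡ countSuffixesBelow X Y
length-filter-drop []      Y f p p∘f≗ = refl
length-filter-drop (x ∷ X) Y f p p∘f≗ rewrite p∘f≗ 0 with lexLt (x ∷ X) Y
... | true  = cong suc (length-filter-drop X Y (f ∘ suc) p (p∘f≗ ∘ suc))
... | false = length-filter-drop X Y (f ∘ suc) p (p∘f≗ ∘ suc)

ISA-countSuffixesBelow : ∀ X j → ISA X j ≡ suc (countSuffixesBelow X (suffix X j))
ISA-countSuffixesBelow X j = cong suc (length-filter-drop X (suffix X j) (λ i → i) _ (λ i → refl))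

countSuffixesBelow-bits : ∀ k {v} B R Y → All (_≤ 1) B → length B ≤ k →
  countSuffixesBelow (B ++ 0 ∷ R) (C k v ++ Y) ≡ suc (length B) + countSuffixesBelow R (C k v ++ Y)
countSuffixesBelow-bits k []      R Y _                   _      = refl
countSuffixesBelow-bits k {v} (b ∷ B) R Y bits@(_ ∷ B-bits) |bB|≤k =
  cong₂ _+_ (cong (λ t → if t then 1 else 0) below)
            (countSuffixesBelow-bits k B R Y B-bits (≤-trans (n≤1+n _) |bB|≤k))
  where
  below : lexLt (b ∷ B ++ 0 ∷ R) (C k v ++ Y) ≡ true
  below = trans (cong (lexLt (b ∷ B ++ 0 ∷ R)) (C-++ k v Y))
                (lexLt-bits-ones (b ∷ B) R (0 ∷ bin k v ++ 0 ∷ Y) bits |bB|≤k)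

countSuffixesBelow-C : ∀ k u {v} X Y →
  countSuffixesBelow (C k u ++ X) (C k v ++ Y)
    ≡ (if lexLt (C k u ++ X) (C k v ++ Y) then 1 else 0) + (2 * k + 2 + countSuffixesBelow X (C k v ++ Y))
countSuffixesBelow-C k u {v} X Y = cong ((if lexLt (C k u ++ X) W then 1 else 0) +_) (begin
  countSuffixesBelow ((replicate k 1 ++ 0 ∷ bin k u ++ [ 0 ]) ++ X) W
    ≡⟨ cong (λ Z → countSuffixesBelow Z W) (∷-injectiveʳ (C-++ k u X)) ⟩
  countSuffixesBelow (replicate k 1 ++ 0 ∷ bin k u ++ 0 ∷ X) W
    ≡⟨ countSuffixesBelow-bits k (replicate k 1) _ Y (replicate⁺ k ≤-refl) (≤-reflexive (length-replicate k)) ⟩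
  suc (length (replicate k 1)) + countSuffixesBelow (bin k u ++ 0 ∷ X) W
    ≡⟨ cong (suc (length (replicate k 1)) +_)
            (countSuffixesBelow-bits k (bin k u) X Y (bin-bits k u) (≤-reflexive (bin-length k u))) ⟩
  suc (length (replicate k 1)) + (suc (length (bin k u)) + countSuffixesBelow X W)
    ≡⟨ cong₂ (λ a b → suc a + (suc b + countSuffixesBelow X W)) (length-replicate k) (bin-length k u) ⟩
  suc k + (suc k + countSuffixesBelow X W)
    ≡⟨ +-assoc (suc k) (suc k) _ ⟨
  (suc k + suc k) + countSuffixesBelow X W
    ≡⟨ cong (_+ countSuffixesBelow X W) (solve (k List.∷ List.[])) ⟩
  2 * k + 2 + countSuffixesBelow X W ∎)
  where
  open ≡-Reasoning
  W = C k v ++ Y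

countSuffixesBelow-encode : ∀ k U v V → All (_< 2 ^ k) U → All (_< 2 ^ k) (v ∷ V) →
  countSuffixesBelow (encode k U) (encode k (v ∷ V)) ≡ countSuffixesBelow U (v ∷ V) + length U * (2 * k + 2)
countSuffixesBelow-encode k []      v V _          _   = refl
countSuffixesBelow-encode k (u ∷ U) v V (u< ∷ U<) vV< = begin
  countSuffixesBelow (C k u ++ encode k U) (C k v ++ encode k V)
    ≡⟨ countSuffixesBelow-C k u (encode k U) (encode k V) ⟩
  ind (lexLt (encode k (u ∷ U)) (encode k (v ∷ V))) + (d + countSuffixesBelow (encode k U) (encode k (v ∷ V)))
    ≡⟨ cong₂ (λ b c → ind b + (d + c)) (encode-lexLt k (u ∷ U) (v ∷ V) (u< ∷ U<) vV<)
                                       (countSuffixesBelow-encode k U v V U< vV<) ⟩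
  ind (lexLt (u ∷ U) (v ∷ V)) + (d + (countSuffixesBelow U (v ∷ V) + length U * d))
    ≡⟨ regroup (ind (lexLt (u ∷ U) (v ∷ V))) (countSuffixesBelow U (v ∷ V)) (length U) d ⟩
  (ind (lexLt (u ∷ U) (v ∷ V)) + countSuffixesBelow U (v ∷ V)) + (d + length U * d) ∎
  where
  open ≡-Reasoning
  d = 2 * k + 2
  ind : Bool → ℕ
  ind b = if b then 1 else 0
  regroup : ∀ a c n e → a + (e + (c + n * e)) ≡ (a + c) + (e + n * e)
  regroup = solve-∀

n≤2^⌈log2⌉n : ∀ n (rec : Acc _<_ n) → n ≤ 2 ^ ⌈log2⌉ n rec
n≤2^⌈log2⌉n 0             _        = z≤n
n≤2^⌈log2⌉n 1             _        = s≤s z≤n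
n≤2^⌈log2⌉n (suc (suc n)) (acc rs) = begin
  suc (suc n)                        ≡⟨ cong (suc ∘ suc) (⌊n/2⌋+⌈n/2⌉≡n n) ⟨
  suc (suc (⌊ n /2⌋ + ⌈ n /2⌉))      ≤⟨ s≤s (s≤s (+-monoˡ-≤ ⌈ n /2⌉ (⌊n/2⌋≤⌈n/2⌉ n))) ⟩
  suc (suc (⌈ n /2⌉ + ⌈ n /2⌉))      ≡⟨ double-suc ⌈ n /2⌉ ⟩
  2 * suc ⌈ n /2⌉                    ≤⟨ *-monoʳ-≤ 2 (n≤2^⌈log2⌉n (suc ⌈ n /2⌉) (rs (⌈n/2⌉<n n))) ⟩
  2 * 2 ^ ⌈log2⌉ (suc ⌈ n /2⌉) _    ∎
  where
  open ≤-Reasoning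
  double-suc : ∀ c → suc (suc (c + c)) ≡ 2 * suc c
  double-suc c = solve (c List.∷ List.[])

n≤2^⌈log₂n⌉ : ∀ n → n ≤ 2 ^ ⌈log₂ n ⌉
n≤2^⌈log₂n⌉ n = n≤2^⌈log2⌉n n (<-wellFounded n)

q<length⇒drop≡∷ : ∀ {A : Set} q (xs : List A) → q < length xs → ∃₂ λ y ys → drop q xs ≡ y ∷ ys
q<length⇒drop≡∷ zero    (x ∷ xs) _         = x , xs , refl
q<length⇒drop≡∷ (suc q) (x ∷ xs) (s≤s q<n) = q<length⇒drop≡∷ q xs q<n

encode-length-∸ : ∀ k T → length (encode k T) ∸ length T ≡ length T * (2 * k + 2)
encode-length-∸ k T = begin
  length (encode k T) ∸ n          ≡⟨ cong (_∸ n) (encode-length k T) ⟩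
  n * (2 * k + 3) ∸ n              ≡⟨ cong (_∸ n) (unfold-+3 n k) ⟩
  n * (2 * k + 2) + n ∸ n          ≡⟨ m+n∸n≡m (n * (2 * k + 2)) n ⟩
  n * (2 * k + 2)                  ∎
  where
  open ≡-Reasoning
  n = length T
  unfold-+3 : ∀ n k → n * (2 * k + 3) ≡ n * (2 * k + 2) + n
  unfold-+3 = solve-∀

mainTheorem13 : (σ : ℕ) → 3 ≤ σ → (T : List ℕ) → 1 ≤ length T → All (λ a → a < σ) T →
  (j : ℕ) → 1 ≤ j → j ≤ length T →
  ISA T j + (length (encode ⌈log₂ σ ⌉ T) ∸ length T)
    ≡ ISA (encode ⌈log₂ σ ⌉ T) ((j ∸ 1) * (2 * ⌈log₂ σ ⌉ + 3) + 1)
mainTheorem13 σ _ T _ T<σ (suc q) (s≤s z≤n) q<n with q<length⇒drop≡∷ q T q<n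
... | v , V , dropT≡ = begin
  ISA T (suc q) + (length S ∸ length T)
    ≡⟨ cong₂ _+_ (ISA-countSuffixesBelow T (suc q)) (encode-length-∸ k T) ⟩
  suc (countSuffixesBelow T (drop q T)) + length T * (2 * k + 2)
    ≡⟨ cong (λ Y → suc (countSuffixesBelow T Y + length T * (2 * k + 2))) dropT≡ ⟩
  suc (countSuffixesBelow T (v ∷ V) + length T * (2 * k + 2))
    ≡⟨ cong suc (countSuffixesBelow-encode k T v V T<2^k (subst (All (_< 2 ^ k)) dropT≡ (drop⁺ q T<2^k))) ⟨
  suc (countSuffixesBelow S (encode k (v ∷ V)))
    ≡⟨ cong (λ Y → suc (countSuffixesBelow S Y)) (trans (suffix-encode k q T) (cong (encode k) dropT≡)) ⟨
  suc (countSuffixesBelow S (suffix S p))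
    ≡⟨ ISA-countSuffixesBelow S p ⟨
  ISA S p ∎
  where
  open ≡-Reasoning
  k = ⌈log₂ σ ⌉
  S = encode k T
  p = q * (2 * k + 3) + 1
  T<2^k : All (_< 2 ^ k) T
  T<2^k = All.map (λ a<σ → <-≤-trans a<σ (n≤2^⌈log₂n⌉ σ)) T<σ
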